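{- Let $\mathcal{B}_n(P)$ denote the set of t-shelves of size $n$ having no node with two children whose left child has a smaller label than its right child. Then $$\sum_{n\ge0}|\mathcal{B}_n(P)|\frac{z^n}{n!} = 1+\frac{ -2}{ -\sqrt{2}\coth\left(\frac{z}{\sqrt2}\right)+2}.$$
   Context: A treeshelf (t-shelf) of size $n\ge 1$ is a rooted binary tree with $n$ nodes labeled bijectively by $\{1,\dots,n\}$ so that labels strictly increase along every path starting at the root, in which every node has at most one left child and at most one right child, and every child (including a child with no sibling) is designated either as the left child or the right child of its parent. There is a unique empty t-shelf, of size $0$. -}

module Defs where

open import Data.Bool using (Bool; true; false; _∧_; T; if_then_else_)
open import Data.Nat using (ℕ; zero; suc; _∸_; _≡ᵇ_; _<ᵇ_; _/_)
open import Data.Nat.Combinatorics using (_C_)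
open import Data.List using (List; []; _∷_; _++_; length; upTo; map)
open import Data.Bool.ListAction using (all; any)
open import Data.Product using (Σ)
open import Data.Integer using (+_)
open import Data.Rational using (ℚ; 0ℚ; 1ℚ; ½)
import Data.Rational as Q

-- Labelled binary trees in which every child is designated left or right.
-- `node l x r` is a node with label x, left subtree l, right subtree r;
-- `∅` means "no child in this position" (or the empty t-shelf).

data Tree : Set where
  ∅    : Tree
  node : Tree → ℕ → Tree → Tree

labels : Tree → List ℕ
labels ∅ = []
labels (node l x r) = x ∷ labels l ++ labels r

labelsAre1ton : ℕ → Tree → Bool
labelsAre1ton n t =
  (length (labels t) ≡ᵇ n)
  ∧ all (λ k → any (λ y → y ≡ᵇ k) (labels t)) (map suc (upTo n))

below : ℕ → Tree → Bool
below x ∅ = true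
below x (node _ y _) = x <ᵇ y

increasing : Tree → Bool
increasing ∅ = true
increasing (node l x r) = below x l ∧ below x r ∧ increasing l ∧ increasing r

isTShelf : ℕ → Tree → Bool
isTShelf n t = labelsAre1ton n t ∧ increasing t

badPair : Tree → Tree → Bool
badPair (node _ a _) (node _ b _) = a <ᵇ b
badPair _ _ = false

not : Bool → Bool
not true = false
not false = true

avoidsP : Tree → Bool
avoidsP ∅ = true
avoidsP (node l _ r) = not (badPair l r) ∧ avoidsP l ∧ avoidsP r

-- 𝓑ₙ(P) as a type; its elements are exactly such trees
-- (the proof component T … has a unique inhabitant).
𝓑 : ℕ → Set
𝓑 n = Σ Tree (λ t → T (isTShelf n t ∧ avoidsP t))

-- Exponential formal power series with rational coefficients:
-- a sequence a represents Σ aₙ zⁿ/n!.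

EGF : Set
EGF = ℕ → ℚ

fromℕ : ℕ → ℚ
fromℕ n = + n Q./ 1

halfPow : ℕ → ℚ
halfPow zero = 1ℚ
halfPow (suc m) = ½ Q.* halfPow m

isEven : ℕ → Bool
isEven zero = true
isEven (suc n) = not (isEven n)

sumTo : ℕ → (ℕ → ℚ) → ℚ
sumTo zero f = f 0
sumTo (suc n) f = sumTo n f Q.+ f (suc n)

_⊛_ : EGF → EGF → EGF
(a ⊛ b) n = sumTo n (λ k → fromℕ (n C k) Q.* (a k Q.* b (n ∸ k)))

_⊝_ : EGF → EGF → EGF
(a ⊝ b) n = a n Q.- b n

oneE : EGF
oneE zero = 1ℚ
oneE (suc _) = 0ℚ

-- coshE = cosh(z/√2) = Σ_{m} z^{2m} / ((2m)! 2^m)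
coshE : EGF
coshE n = if isEven n then halfPow (n / 2) else 0ℚ

-- sinhE = √2 · sinh(z/√2) = Σ_{m} z^{2m+1} / ((2m+1)! 2^m)
sinhE : EGF
sinhE n = if isEven n then 0ℚ else halfPow (n / 2)

{-# OPTIONS --safe #-}
-- A P-avoiding shelf with labels x₀ < x₁ < ⋯ < xₙ₊₁ has root x₀, and its subtrees carry a
-- split (A , B) of the remaining labels; the root is a bad node exactly when B ≠ ∅ and x₁ ∈ A.
-- So either B = ∅, or x₁ is the root of the right subtree and k of the other n labels go left:
-- b (n+2) = b (n+1) + Σₖ C(n,k) bₖ bₙ₋ₖ₊₁. For F = Σ bₙ zⁿ/n! this reads F″ = F′ + F F′, and
-- integrating once with F(0) = F′(0) = 1 gives F′ = F + (F² − 1)/2. With C = cosh(z/√2) and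
-- S = √2 sinh(z/√2), so that C′ = S/2 and S′ = C, the coefficients of (F − 1)(C − S) then obey
-- the same recursion as those of S, starting from 0.
--
-- As 𝓑ₙ is only known through a bijection with Fin (b n), b n is computed as the length of an
-- explicit list that contains every P-avoiding shelf on {1, …, n} exactly once.
module Submission where

open import Defs
open import Data.Nat using (ℕ)
open import Data.Fin using (Fin)
open import Data.Rational using (ℚ)
open import Function.Bundles using (_↔_)
open import Relation.Binary.PropositionalEquality using (_≡_)
open import Algebra.Core using (Op₂)
open import Data.Nat using (zero; suc; _≤_; _<_; z≤n; s≤s)
import Data.Nat as ℕ
import Data.Nat.Properties as ℕ
import Data.Rational as ℚ
open import Function using (_∘_)
open import Relation.Binary.PropositionalEquality
  using (_≗_; refl; sym; trans; cong; cong₂; subst; module ≡-Reasoning)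

-- On exponential generating functions ∂ is differentiation and _⋆_ is the product,
-- defined here through the Leibniz rule.
module Leibniz {A : Set} (_⊕_ _⊗_ : Op₂ A) where

  ∂ : (ℕ → A) → ℕ → A
  ∂ a n = a (suc n)

  infixl 7 _⋆_
  _⋆_ : (ℕ → A) → (ℕ → A) → ℕ → A
  (a ⋆ b) zero    = a 0 ⊗ b 0
  (a ⋆ b) (suc n) = (∂ a ⋆ b) n ⊕ (a ⋆ ∂ b) n

  ⋆-cong-≤ : ∀ {a a′ b b′} n → (∀ {k} → k ≤ n → a k ≡ a′ k) → (∀ {k} → k ≤ n → b k ≡ b′ k) →
             (a ⋆ b) n ≡ (a′ ⋆ b′) n
  ⋆-cong-≤ zero    a≡a′ b≡b′ = cong₂ _⊗_ (a≡a′ z≤n) (b≡b′ z≤n)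
  ⋆-cong-≤ (suc n) a≡a′ b≡b′ = cong₂ _⊕_
    (⋆-cong-≤ n (a≡a′ ∘ s≤s) (b≡b′ ∘ ℕ.m≤n⇒m≤1+n))
    (⋆-cong-≤ n (a≡a′ ∘ ℕ.m≤n⇒m≤1+n) (b≡b′ ∘ s≤s))

  ⋆-cong : ∀ {a a′ b b′} → a ≗ a′ → b ≗ b′ → a ⋆ b ≗ a′ ⋆ b′
  ⋆-cong a≗a′ b≗b′ n = ⋆-cong-≤ n (λ {k} _ → a≗a′ k) (λ {k} _ → b≗b′ k)

module _ {A B : Set} {_⊕_ _⊗_ : Op₂ A} {_⊕′_ _⊗′_ : Op₂ B} (f : A → B)
         (f-⊕ : ∀ x y → f (x ⊕ y) ≡ f x ⊕′ f y) (f-⊗ : ∀ x y → f (x ⊗ y) ≡ f x ⊗′ f y) where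
  private
    module L  = Leibniz _⊕_ _⊗_
    module L′ = Leibniz _⊕′_ _⊗′_

  ⋆-homo : ∀ a b → f ∘ (a L.⋆ b) ≗ (f ∘ a) L′.⋆ (f ∘ b)
  ⋆-homo a b zero    = f-⊗ (a 0) (b 0)
  ⋆-homo a b (suc n) = trans (f-⊕ _ _) (cong₂ _⊕′_ (⋆-homo (L.∂ a) b n) (⋆-homo a (L.∂ b) n))

module PowerSeries where
  open import Algebra.Bundles using (CommutativeMonoid)
  import Algebra.Properties.CommutativeSemigroup as CommutativeSemigroupProperties
  open import Data.Bool using (true; false; if_then_else_)
  import Data.Integer as ℤ
  import Data.Integer.Properties as ℤ
  open import Data.Nat using (_∸_; _/_)
  open import Data.Nat.Combinatorics using (_C_; nCk+nC[k+1]≡[n+1]C[k+1]; k>n⇒nCk≡0)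
  import Data.Nat.Coprimality as Coprime
  open import Data.Nat.DivMod using (m/n≡1+[m∸n]/n)
  open import Data.Nat.Induction using (<-rec)
  open import Data.Rational using (0ℚ; 1ℚ; ½; _+_; _*_; _-_; -_)
  open import Data.Rational.Properties
    using (normalize-coprime; +-comm; +-assoc; +-identityˡ; +-identityʳ; *-comm; *-assoc; *-identityˡ; *-zeroˡ;
           *-distribˡ-+; *-distribʳ-+; neg-distrib-+; neg-distribˡ-*; +-0-commutativeMonoid)
  open import Data.Rational.Solver using (module +-*-Solver)
  open +-*-Solver
  open CommutativeSemigroupProperties (CommutativeMonoid.commutativeSemigroup +-0-commutativeMonoid)
    using (interchange; x∙yz≈y∙xz)
  open ≡-Reasoning

  open Leibniz _+_ _*_ public

  infixl 6 _⊕_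
  _⊕_ : EGF → EGF → EGF
  (a ⊕ b) n = a n + b n

  infix 8 ⊖_
  ⊖_ : EGF → EGF
  (⊖ a) n = - a n

  infixr 7 _∙_
  _∙_ : ℚ → EGF → EGF
  (x ∙ a) n = x * a n

  fromℕ≡mkℚ : ∀ n → fromℕ n ≡ ℚ.mkℚ (ℤ.+ n) 0 (Coprime.sym (Coprime.1-coprimeTo n))
  fromℕ≡mkℚ n = normalize-coprime _

  fromℕ-homo-+ : ∀ m n → fromℕ (m ℕ.+ n) ≡ fromℕ m + fromℕ n
  fromℕ-homo-+ m n = begin
    ℤ.+ (m ℕ.+ n) ℚ./ 1
      ≡⟨ cong (ℚ._/ 1) (ℤ.pos-+ m n) ⟩
    (ℤ.+ m ℤ.+ ℤ.+ n) ℚ./ 1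
      ≡⟨ cong₂ (λ i j → (i ℤ.+ j) ℚ./ 1) (ℤ.*-identityʳ (ℤ.+ m)) (ℤ.*-identityʳ (ℤ.+ n)) ⟨
    (ℤ.+ m ℤ.* ℤ.+ 1 ℤ.+ ℤ.+ n ℤ.* ℤ.+ 1) ℚ./ 1
      ≡⟨ cong₂ _+_ (fromℕ≡mkℚ m) (fromℕ≡mkℚ n) ⟨
    fromℕ m + fromℕ n
      ∎

  fromℕ-homo-* : ∀ m n → fromℕ (m ℕ.* n) ≡ fromℕ m * fromℕ n
  fromℕ-homo-* m n = begin
    ℤ.+ (m ℕ.* n) ℚ./ 1      ≡⟨ cong (ℚ._/ 1) (ℤ.pos-* m n) ⟩
    (ℤ.+ m ℤ.* ℤ.+ n) ℚ./ 1  ≡⟨ cong₂ _*_ (fromℕ≡mkℚ m) (fromℕ≡mkℚ n) ⟨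
    fromℕ m * fromℕ n        ∎

  ⋆-comm : ∀ a b → a ⋆ b ≗ b ⋆ a
  ⋆-comm a b zero    = *-comm (a 0) (b 0)
  ⋆-comm a b (suc n) = trans (cong₂ _+_ (⋆-comm (∂ a) b n) (⋆-comm a (∂ b) n)) (+-comm ((b ⋆ ∂ a) n) ((∂ b ⋆ a) n))

  ⋆-distribʳ-+ : ∀ a b c → (a ⊕ b) ⋆ c ≗ (a ⋆ c) ⊕ (b ⋆ c)
  ⋆-distribʳ-+ a b c zero    = *-distribʳ-+ (c 0) (a 0) (b 0)
  ⋆-distribʳ-+ a b c (suc n) = trans
    (cong₂ _+_ (⋆-distribʳ-+ (∂ a) (∂ b) c n) (⋆-distribʳ-+ a b (∂ c) n))
    (interchange ((∂ a ⋆ c) n) ((∂ b ⋆ c) n) ((a ⋆ ∂ c) n) ((b ⋆ ∂ c) n))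

  ⋆-distribˡ-+ : ∀ a b c → a ⋆ (b ⊕ c) ≗ (a ⋆ b) ⊕ (a ⋆ c)
  ⋆-distribˡ-+ a b c n = begin
    (a ⋆ (b ⊕ c)) n        ≡⟨ ⋆-comm a (b ⊕ c) n ⟩
    ((b ⊕ c) ⋆ a) n        ≡⟨ ⋆-distribʳ-+ b c a n ⟩
    (b ⋆ a) n + (c ⋆ a) n  ≡⟨ cong₂ _+_ (⋆-comm b a n) (⋆-comm c a n) ⟩
    (a ⋆ b) n + (a ⋆ c) n  ∎

  ⋆-scaleˡ : ∀ x a b → (x ∙ a) ⋆ b ≗ x ∙ (a ⋆ b)
  ⋆-scaleˡ x a b zero    = *-assoc x (a 0) (b 0)
  ⋆-scaleˡ x a b (suc n) = trans
    (cong₂ _+_ (⋆-scaleˡ x (∂ a) b n) (⋆-scaleˡ x a (∂ b) n))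
    (sym (*-distribˡ-+ x ((∂ a ⋆ b) n) ((a ⋆ ∂ b) n)))

  ⋆-scaleʳ : ∀ x a b → a ⋆ (x ∙ b) ≗ x ∙ (a ⋆ b)
  ⋆-scaleʳ x a b n = trans (⋆-comm a (x ∙ b) n) (trans (⋆-scaleˡ x b a n) (cong (x *_) (⋆-comm b a n)))

  ⋆-negˡ : ∀ a b → (⊖ a) ⋆ b ≗ ⊖ (a ⋆ b)
  ⋆-negˡ a b zero    = sym (neg-distribˡ-* (a 0) (b 0))
  ⋆-negˡ a b (suc n) = trans
    (cong₂ _+_ (⋆-negˡ (∂ a) b n) (⋆-negˡ a (∂ b) n))
    (sym (neg-distrib-+ ((∂ a ⋆ b) n) ((a ⋆ ∂ b) n)))

  ⋆-negʳ : ∀ a b → a ⋆ (⊖ b) ≗ ⊖ (a ⋆ b)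
  ⋆-negʳ a b n = trans (⋆-comm a (⊖ b) n) (trans (⋆-negˡ b a n) (cong -_ (⋆-comm b a n)))

  ⋆-assoc : ∀ a b c → (a ⋆ b) ⋆ c ≗ a ⋆ (b ⋆ c)
  ⋆-assoc a b c zero    = *-assoc (a 0) (b 0) (c 0)
  ⋆-assoc a b c (suc n) = begin
    ((∂ a ⋆ b ⊕ a ⋆ ∂ b) ⋆ c) n + ((a ⋆ b) ⋆ ∂ c) n
      ≡⟨ cong (_+ ((a ⋆ b) ⋆ ∂ c) n) (⋆-distribʳ-+ (∂ a ⋆ b) (a ⋆ ∂ b) c n) ⟩
    (((∂ a ⋆ b) ⋆ c) n + ((a ⋆ ∂ b) ⋆ c) n) + ((a ⋆ b) ⋆ ∂ c) n
      ≡⟨ cong₂ _+_ (cong₂ _+_ (⋆-assoc (∂ a) b c n) (⋆-assoc a (∂ b) c n)) (⋆-assoc a b (∂ c) n) ⟩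
    ((∂ a ⋆ (b ⋆ c)) n + (a ⋆ (∂ b ⋆ c)) n) + (a ⋆ (b ⋆ ∂ c)) n
      ≡⟨ +-assoc ((∂ a ⋆ (b ⋆ c)) n) ((a ⋆ (∂ b ⋆ c)) n) ((a ⋆ (b ⋆ ∂ c)) n) ⟩
    (∂ a ⋆ (b ⋆ c)) n + ((a ⋆ (∂ b ⋆ c)) n + (a ⋆ (b ⋆ ∂ c)) n)
      ≡⟨ cong ((∂ a ⋆ (b ⋆ c)) n +_) (⋆-distribˡ-+ a (∂ b ⋆ c) (b ⋆ ∂ c) n) ⟨
    (∂ a ⋆ (b ⋆ c)) n + (a ⋆ (∂ b ⋆ c ⊕ b ⋆ ∂ c)) n
      ∎

  ⋆-zeroˡ : ∀ b → (λ _ → 0ℚ) ⋆ b ≗ λ _ → 0ℚ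
  ⋆-zeroˡ b zero    = *-zeroˡ (b 0)
  ⋆-zeroˡ b (suc n) = cong₂ _+_ (⋆-zeroˡ b n) (⋆-zeroˡ (∂ b) n)

  ⋆-identityˡ : ∀ b → oneE ⋆ b ≗ b
  ⋆-identityˡ b zero    = *-identityˡ (b 0)
  ⋆-identityˡ b (suc n) = trans (cong₂ _+_ (⋆-zeroˡ b n) (⋆-identityˡ (∂ b) n)) (+-identityˡ (b (suc n)))

  ⋆-identityʳ : ∀ a → a ⋆ oneE ≗ a
  ⋆-identityʳ a n = trans (⋆-comm a oneE n) (⋆-identityˡ a n)

  sumTo-cong : ∀ n {f g : ℕ → ℚ} → (∀ {k} → k ≤ n → f k ≡ g k) → sumTo n f ≡ sumTo n g
  sumTo-cong zero    f≡g = f≡g z≤n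
  sumTo-cong (suc n) f≡g = cong₂ _+_ (sumTo-cong n (f≡g ∘ ℕ.m≤n⇒m≤1+n)) (f≡g ℕ.≤-refl)

  sumTo-+ : ∀ n f g → sumTo n (f ⊕ g) ≡ sumTo n f + sumTo n g
  sumTo-+ zero    f g = refl
  sumTo-+ (suc n) f g = trans (cong (_+ (f (suc n) + g (suc n))) (sumTo-+ n f g))
                              (interchange (sumTo n f) (sumTo n g) (f (suc n)) (g (suc n)))

  sumTo-sucˡ : ∀ n f → sumTo (suc n) f ≡ f 0 + sumTo n (f ∘ suc)
  sumTo-sucˡ zero    f = refl
  sumTo-sucˡ (suc n) f = trans (cong (_+ f (suc (suc n))) (sumTo-sucˡ n f))
                               (+-assoc (f 0) (sumTo n (f ∘ suc)) (f (suc (suc n))))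

  ⊛-leibniz : ∀ a b n → (a ⊛ b) (suc n) ≡ (∂ a ⊛ b) n + (a ⊛ ∂ b) n
  ⊛-leibniz a b n = begin
    sumTo (suc n) w
      ≡⟨ sumTo-sucˡ n w ⟩
    w 0 + sumTo n (w ∘ suc)
      ≡⟨ cong (w 0 +_) (trans (sumTo-cong n (λ {j} _ → pascal j)) (sumTo-+ n u (v ∘ suc))) ⟩
    w 0 + (sumTo n u + sumTo n (v ∘ suc))
      ≡⟨ x∙yz≈y∙xz (w 0) (sumTo n u) (sumTo n (v ∘ suc)) ⟩
    sumTo n u + (v 0 + sumTo n (v ∘ suc))
      ≡⟨ cong (sumTo n u +_) (sumTo-sucˡ n v) ⟨
    sumTo n u + (sumTo n v + v (suc n))
      ≡⟨ cong (λ x → sumTo n u + (sumTo n v + x)) last-term≡0 ⟩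
    sumTo n u + (sumTo n v + 0ℚ)
      ≡⟨ cong (sumTo n u +_) (+-identityʳ (sumTo n v)) ⟩
    sumTo n u + sumTo n v
      ≡⟨ cong (sumTo n u +_) (sumTo-cong n (λ {k} k≤n → cong (λ m → fromℕ (n C k) * (a k * b m))
                                                             (ℕ.+-∸-assoc 1 k≤n))) ⟩
    (∂ a ⊛ b) n + (a ⊛ ∂ b) n
      ∎
    where
    w u v : ℕ → ℚ
    w k = fromℕ (suc n C k) * (a k * b (suc n ∸ k))
    u k = fromℕ (n C k) * (a (suc k) * b (n ∸ k))
    v k = fromℕ (n C k) * (a k * b (suc n ∸ k))
    pascal : ∀ j → w (suc j) ≡ u j + v (suc j)
    pascal j = begin
      fromℕ (suc n C suc j) * x                ≡⟨ cong (λ c → fromℕ c * x) (nCk+nC[k+1]≡[n+1]C[k+1] n j) ⟨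
      fromℕ (n C j ℕ.+ n C suc j) * x          ≡⟨ cong (_* x) (fromℕ-homo-+ (n C j) (n C suc j)) ⟩
      (fromℕ (n C j) + fromℕ (n C suc j)) * x  ≡⟨ *-distribʳ-+ x (fromℕ (n C j)) (fromℕ (n C suc j)) ⟩
      u j + v (suc j)                          ∎
      where x = a (suc j) * b (n ∸ j)
    last-term≡0 : v (suc n) ≡ 0ℚ
    last-term≡0 = trans (cong (λ c → fromℕ c * (a (suc n) * b (n ∸ n))) (k>n⇒nCk≡0 (ℕ.n<1+n n)))
                        (*-zeroˡ (a (suc n) * b (n ∸ n)))

  ⊛≗⋆ : ∀ a b → a ⊛ b ≗ a ⋆ b
  ⊛≗⋆ a b zero    = *-identityˡ (a 0 * b 0)
  ⊛≗⋆ a b (suc n) = trans (⊛-leibniz a b n) (cong₂ _+_ (⊛≗⋆ (∂ a) b n) (⊛≗⋆ a (∂ b) n))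

  suc-/2 : ∀ k → suc k / 2 ≡ (if isEven k then k / 2 else suc (k / 2))
  suc-/2 zero    = refl
  suc-/2 (suc k) with isEven k | suc-/2 k
  ... | true  | ih = trans (m/n≡1+[m∸n]/n {suc (suc k)} {2} (s≤s (s≤s z≤n))) (cong suc (sym ih))
  ... | false | ih = trans (m/n≡1+[m∸n]/n {suc (suc k)} {2} (s≤s (s≤s z≤n))) (sym ih)

  ∂coshE : ∂ coshE ≗ ½ ∙ sinhE
  ∂coshE k with isEven k | suc-/2 k
  ... | true  | _       = refl
  ... | false | k+1/2≡ = cong halfPow k+1/2≡

  ∂sinhE : ∂ sinhE ≗ coshE
  ∂sinhE k with isEven k | suc-/2 k
  ... | true  | k+1/2≡ = cong halfPow k+1/2≡
  ... | false | _       = refl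

  module _ (a : EGF) (a₀ : a 0 ≡ 1ℚ) (a₁ : a 1 ≡ 1ℚ)
           (a-rec : ∀ n → a (suc (suc n)) ≡ a (suc n) + (a ⋆ ∂ a) n) where

    private
      g d P : EGF
      g = a ⊝ oneE
      d = coshE ⊝ sinhE
      P = g ⋆ d

      -- Integrating a″ = a′ + a a′ once, using a(0) = a′(0) = 1.
      ∂a≡ : ∀ n → ∂ a n ≡ a n + ½ * (a ⋆ a) n - ½ * oneE n
      ∂a≡ zero    rewrite a₀ | a₁ = refl
      ∂a≡ (suc n) = begin
        a (suc (suc n))
          ≡⟨ a-rec n ⟩
        a (suc n) + (a ⋆ ∂ a) n
          ≡⟨ solve 2 (λ x y → x :+ y := x :+ con ½ :* (y :+ y) :- con ½ :* con 0ℚ) refl (a (suc n)) ((a ⋆ ∂ a) n) ⟩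
        a (suc n) + ½ * ((a ⋆ ∂ a) n + (a ⋆ ∂ a) n) - ½ * 0ℚ
          ≡⟨ cong (λ x → a (suc n) + ½ * (x + (a ⋆ ∂ a) n) - ½ * 0ℚ) (⋆-comm a (∂ a) n) ⟩
        a (suc n) + ½ * ((∂ a ⋆ a) n + (a ⋆ ∂ a) n) - ½ * 0ℚ
          ∎

      a⋆a≡ : ∀ n → (a ⋆ a) n ≡ (g ⋆ g) n + (g n + g n) + oneE n
      a⋆a≡ n = begin
        (a ⋆ a) n
          ≡⟨ ⋆-cong a≗g⊕1 a≗g⊕1 n ⟩
        ((g ⊕ oneE) ⋆ (g ⊕ oneE)) n
          ≡⟨ ⋆-distribʳ-+ g oneE (g ⊕ oneE) n ⟩
        (g ⋆ (g ⊕ oneE)) n + (oneE ⋆ (g ⊕ oneE)) n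
          ≡⟨ cong₂ _+_ (⋆-distribˡ-+ g g oneE n) (⋆-identityˡ (g ⊕ oneE) n) ⟩
        ((g ⋆ g) n + (g ⋆ oneE) n) + (g n + oneE n)
          ≡⟨ cong (λ x → ((g ⋆ g) n + x) + (g n + oneE n)) (⋆-identityʳ g n) ⟩
        ((g ⋆ g) n + g n) + (g n + oneE n)
          ≡⟨ solve 3 (λ x y z → (x :+ y) :+ (y :+ z) := x :+ (y :+ y) :+ z) refl ((g ⋆ g) n) (g n) (oneE n) ⟩
        (g ⋆ g) n + (g n + g n) + oneE n
          ∎
        where
        a≗g⊕1 : a ≗ g ⊕ oneE
        a≗g⊕1 k = solve 2 (λ x y → x := (x :- y) :+ y) refl (a k) (oneE k)

      ∂g≗ : ∂ g ≗ (g ⊕ g ⊕ oneE) ⊕ ½ ∙ (g ⋆ g)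
      ∂g≗ n = begin
        a (suc n) - 0ℚ
          ≡⟨ cong (_- 0ℚ) (∂a≡ n) ⟩
        a n + ½ * (a ⋆ a) n - ½ * oneE n - 0ℚ
          ≡⟨ cong (λ x → a n + ½ * x - ½ * oneE n - 0ℚ) (a⋆a≡ n) ⟩
        a n + ½ * ((g ⋆ g) n + (g n + g n) + oneE n) - ½ * oneE n - 0ℚ
          ≡⟨ solve 3 (λ x o q → x :+ con ½ :* (q :+ ((x :- o) :+ (x :- o)) :+ o) :- con ½ :* o :- con 0ℚ
                                := (x :- o) :+ (x :- o) :+ o :+ con ½ :* q)
                   refl (a n) (oneE n) ((g ⋆ g) n) ⟩
        (g n + g n + oneE n) + ½ * (g ⋆ g) n
          ∎

      ∂d≗ : ∂ d ≗ ½ ∙ sinhE ⊕ ⊖ coshE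
      ∂d≗ n = cong₂ _-_ (∂coshE n) (∂sinhE n)

      -- (g d)′ = (2g + 1 + g²/2) d + g (sinhE/2 − coshE). Up to degree n, where g d agrees with
      -- sinhE, g² d may be replaced by g sinhE and coshE by d + sinhE; everything then cancels
      -- down to g d + d = sinhE + d = coshE = sinhE′.
      P-step : ∀ n → (∀ {k} → k ≤ n → P k ≡ sinhE k) → P (suc n) ≡ sinhE (suc n)
      P-step n P≡S = begin
        (∂ g ⋆ d) n + (g ⋆ ∂ d) n
          ≡⟨ cong₂ _+_ ∂g⋆d≡ g⋆∂d≡ ⟩
        (P n + P n + d n + ½ * G) + (½ * G + - (P n + G))
          ≡⟨ solve 3 (λ p x y → p :+ p :+ x :+ con ½ :* y :+ (con ½ :* y :+ :- (p :+ y)) := p :+ x)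
                   refl (P n) (d n) G ⟩
        P n + d n
          ≡⟨ cong (_+ d n) (P≡S ℕ.≤-refl) ⟩
        sinhE n + (coshE n - sinhE n)
          ≡⟨ solve 2 (λ s c → s :+ (c :- s) := c) refl (sinhE n) (coshE n) ⟩
        coshE n
          ≡⟨ ∂sinhE n ⟨
        sinhE (suc n)
          ∎
        where
        G : ℚ
        G = (g ⋆ sinhE) n
        ∂g⋆d≡ : (∂ g ⋆ d) n ≡ P n + P n + d n + ½ * G
        ∂g⋆d≡ = begin
          (∂ g ⋆ d) n
            ≡⟨ ⋆-cong ∂g≗ (λ _ → refl) n ⟩
          ((g ⊕ g ⊕ oneE ⊕ ½ ∙ (g ⋆ g)) ⋆ d) n
            ≡⟨ ⋆-distribʳ-+ (g ⊕ g ⊕ oneE) (½ ∙ (g ⋆ g)) d n ⟩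
          ((g ⊕ g ⊕ oneE) ⋆ d) n + ((½ ∙ (g ⋆ g)) ⋆ d) n
            ≡⟨ cong₂ _+_ (trans (⋆-distribʳ-+ (g ⊕ g) oneE d n) (cong₂ _+_ (⋆-distribʳ-+ g g d n) (⋆-identityˡ d n)))
                         (⋆-scaleˡ ½ (g ⋆ g) d n) ⟩
          P n + P n + d n + ½ * ((g ⋆ g) ⋆ d) n
            ≡⟨ cong (λ x → P n + P n + d n + ½ * x) (trans (⋆-assoc g g d n) (⋆-cong-≤ n (λ _ → refl) P≡S)) ⟩
          P n + P n + d n + ½ * G
            ∎
        g⋆∂d≡ : (g ⋆ ∂ d) n ≡ ½ * G + - (P n + G)
        g⋆∂d≡ = begin
          (g ⋆ ∂ d) n
            ≡⟨ ⋆-cong (λ _ → refl) ∂d≗ n ⟩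
          (g ⋆ (½ ∙ sinhE ⊕ ⊖ coshE)) n
            ≡⟨ ⋆-distribˡ-+ g (½ ∙ sinhE) (⊖ coshE) n ⟩
          (g ⋆ (½ ∙ sinhE)) n + (g ⋆ (⊖ coshE)) n
            ≡⟨ cong₂ _+_ (⋆-scaleʳ ½ g sinhE n) (⋆-negʳ g coshE n) ⟩
          ½ * G + - (g ⋆ coshE) n
            ≡⟨ cong (λ x → ½ * G + - x) (trans (⋆-cong (λ _ → refl) coshE≗d⊕sinhE n) (⋆-distribˡ-+ g d sinhE n)) ⟩
          ½ * G + - (P n + G)
            ∎
          where
          coshE≗d⊕sinhE : coshE ≗ d ⊕ sinhE
          coshE≗d⊕sinhE k = solve 2 (λ c s → c := (c :- s) :+ s) refl (coshE k) (sinhE k)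

      P≗sinhE : P ≗ sinhE
      P≗sinhE = <-rec _ λ where
        zero    _  → cong (λ x → (x - 1ℚ) * (coshE 0 - sinhE 0)) a₀
        (suc n) ih → P-step n (λ k≤n → ih (s≤s k≤n))

    recurrence⇒egf-identity : ∀ n → ((a ⊝ oneE) ⊛ (coshE ⊝ sinhE)) n ≡ sinhE n
    recurrence⇒egf-identity n = trans (⊛≗⋆ g d n) (P≗sinhE n)

module Sums where
  open import Data.Bool using (Bool; true; false; _∧_; T)
  open import Data.Bool.Properties using (T-irrelevant)
  open import Data.Empty using (⊥)
  open import Data.Fin using (zero; suc)
  open import Data.Fin.Properties using (cantor-schröder-bernstein)
  open import Data.List using (List; []; _∷_; _++_; map; length; lookup; concatMap)
  open import Data.List.Membership.Propositional using (_∈_)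
  open import Data.List.Properties using (map-++)
  open import Data.List.Relation.Unary.Any using (here; there; index)
  open import Data.List.Relation.Unary.Any.Properties using (lookup-index)
  open import Data.Nat using (_+_; _*_)
  open import Data.Nat.ListAction using (sum)
  open import Data.Nat.ListAction.Properties using (sum-++)
  open import Data.Product using (Σ; _,_; proj₁; proj₂)
  open import Function using (Inverse)
  open import Relation.Binary.Definitions using (DecidableEquality)
  open import Relation.Nullary using (Dec; does; yes; no; ¬_; contradiction)
  open import Relation.Nullary.Decidable using (dec-true)
  open ≡-Reasoning

  ⟦_⟧ : Bool → ℕ
  ⟦ true  ⟧ = 1
  ⟦ false ⟧ = 0

  ⟦∧⟧ : ∀ a b → ⟦ a ∧ b ⟧ ≡ ⟦ a ⟧ * ⟦ b ⟧
  ⟦∧⟧ true  b = sym (ℕ.+-identityʳ ⟦ b ⟧)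
  ⟦∧⟧ false b = refl

  ⟦∧⟧³ : ∀ a b c d → ⟦ a ∧ (b ∧ (c ∧ d)) ⟧ ≡ ⟦ a ⟧ * (⟦ b ⟧ * (⟦ c ⟧ * ⟦ d ⟧))
  ⟦∧⟧³ a b c d = trans (⟦∧⟧ a _) (cong (⟦ a ⟧ *_) (trans (⟦∧⟧ b _) (cong (⟦ b ⟧ *_) (⟦∧⟧ c d))))

  ⟦⟧≤1 : ∀ a → ⟦ a ⟧ ≤ 1
  ⟦⟧≤1 true  = s≤s z≤n
  ⟦⟧≤1 false = z≤n

  ⟦⟧≥1⇒T : ∀ {a} → 1 ≤ ⟦ a ⟧ → T a
  ⟦⟧≥1⇒T {true} _ = _

  T⇒⟦⟧≥1 : ∀ {a} → T a → 1 ≤ ⟦ a ⟧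
  T⇒⟦⟧≥1 {true} _ = s≤s z≤n

  ⟦⟧*⟦⟧≡0 : ∀ {a b} → (T a → T b → ⊥) → ⟦ a ⟧ * ⟦ b ⟧ ≡ 0
  ⟦⟧*⟦⟧≡0 {true}  {true}  ¬ab = contradiction _ (¬ab _)
  ⟦⟧*⟦⟧≡0 {true}  {false} _   = refl
  ⟦⟧*⟦⟧≡0 {false}         _   = refl

  T-does⇒ : ∀ {P : Set} (p? : Dec P) → T (does p?) → P
  T-does⇒ (yes p) _ = p

  ∑ : {A : Set} → List A → (A → ℕ) → ℕ
  ∑ xs f = sum (map f xs)

  infix 5 ∑
  syntax ∑ xs (λ x → e) = ∑[ x ∈ xs ] e

  module _ {A : Set} where

    ∑-++ : ∀ xs ys (f : A → ℕ) → ∑ (xs ++ ys) f ≡ ∑ xs f + ∑ ys f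
    ∑-++ xs ys f = trans (cong sum (map-++ f xs ys)) (sum-++ (map f xs) (map f ys))

    ∑-map : ∀ {B : Set} (g : B → A) xs (f : A → ℕ) → ∑ (map g xs) f ≡ ∑ xs (f ∘ g)
    ∑-map g []       f = refl
    ∑-map g (x ∷ xs) f = cong (f (g x) +_) (∑-map g xs f)

    ∑-concatMap : ∀ {B : Set} (g : B → List A) xs (f : A → ℕ) → ∑ (concatMap g xs) f ≡ ∑[ x ∈ xs ] ∑ (g x) f
    ∑-concatMap g []       f = refl
    ∑-concatMap g (x ∷ xs) f = trans (∑-++ (g x) (concatMap g xs) f) (cong (∑ (g x) f +_) (∑-concatMap g xs f))

    ∑-cong : ∀ {f g : A → ℕ} xs → (∀ {x} → x ∈ xs → f x ≡ g x) → ∑ xs f ≡ ∑ xs g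
    ∑-cong []       f≡g = refl
    ∑-cong (x ∷ xs) f≡g = cong₂ _+_ (f≡g (here refl)) (∑-cong xs (f≡g ∘ there))

    ∑-zero : ∀ (xs : List A) → ∑[ x ∈ xs ] 0 ≡ 0
    ∑-zero []       = refl
    ∑-zero (x ∷ xs) = ∑-zero xs

    ∑-*ˡ : ∀ c (f : A → ℕ) xs → ∑[ x ∈ xs ] c * f x ≡ c * ∑ xs f
    ∑-*ˡ c f []       = sym (ℕ.*-zeroʳ c)
    ∑-*ˡ c f (x ∷ xs) = trans (cong (c * f x +_) (∑-*ˡ c f xs)) (sym (ℕ.*-distribˡ-+ c (f x) (∑ xs f)))

    ∑-*ʳ : ∀ c (f : A → ℕ) xs → ∑[ x ∈ xs ] f x * c ≡ ∑ xs f * c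
    ∑-*ʳ c f xs = trans (∑-cong xs (λ {x} _ → ℕ.*-comm (f x) c)) (trans (∑-*ˡ c f xs) (ℕ.*-comm c (∑ xs f)))

    length≡∑1 : ∀ (xs : List A) → length xs ≡ ∑[ x ∈ xs ] 1
    length≡∑1 []       = refl
    length≡∑1 (x ∷ xs) = cong suc (length≡∑1 xs)


  length-concatMap : ∀ {A B : Set} (g : B → List A) xs → length (concatMap g xs) ≡ ∑[ x ∈ xs ] length (g x)
  length-concatMap g xs = trans (length≡∑1 (concatMap g xs))
    (trans (∑-concatMap g xs (λ _ → 1)) (∑-cong xs (λ {x} _ → sym (length≡∑1 (g x)))))

  module Multiplicity {A : Set} (_≟_ : DecidableEquality A) where

    multiplicity : A → List A → ℕ
    multiplicity x xs = ∑[ y ∈ xs ] ⟦ does (x ≟ y) ⟧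

    multiplicity-lookup : ∀ xs i → 1 ≤ multiplicity (lookup xs i) xs
    multiplicity-lookup (x ∷ xs) zero    rewrite dec-true (x ≟ x) refl = s≤s z≤n
    multiplicity-lookup (x ∷ xs) (suc i) = ℕ.≤-trans (multiplicity-lookup xs i) (ℕ.m≤n+m _ _)

    multiplicity≥1⇒∈ : ∀ {x} xs → 1 ≤ multiplicity x xs → x ∈ xs
    multiplicity≥1⇒∈ {x} (y ∷ ys) m≥1 with x ≟ y
    ... | yes x≡y = here x≡y
    ... | no  _   = there (multiplicity≥1⇒∈ ys m≥1)

    head-not-repeated : ∀ {x} xs j → x ≡ lookup xs j → ¬ multiplicity x (x ∷ xs) ≤ 1
    head-not-repeated {x} xs j refl rewrite dec-true (x ≟ x) refl = λ where
      (s≤s m≤0) → ℕ.<⇒≱ (multiplicity-lookup xs j) m≤0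

    lookup-injective : ∀ xs → (∀ x → multiplicity x xs ≤ 1) → ∀ i j → lookup xs i ≡ lookup xs j → i ≡ j
    lookup-injective (x ∷ xs) m≤1 zero    zero    _     = refl
    lookup-injective (x ∷ xs) m≤1 zero    (suc j) x≡xⱼ  = contradiction (m≤1 x) (head-not-repeated xs j x≡xⱼ)
    lookup-injective (x ∷ xs) m≤1 (suc i) zero    xᵢ≡x  = contradiction (m≤1 x) (head-not-repeated xs i (sym xᵢ≡x))
    lookup-injective (x ∷ xs) m≤1 (suc i) (suc j) xᵢ≡xⱼ =
      cong suc (lookup-injective xs (λ y → ℕ.≤-trans (ℕ.m≤n+m _ _) (m≤1 y)) i j xᵢ≡xⱼ)

    enumeration⇒≡length : ∀ {P : A → Bool} {m} xs → (∀ x → multiplicity x xs ≡ ⟦ P x ⟧) →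
                          Fin m ↔ Σ A (T ∘ P) → m ≡ length xs
    enumeration⇒≡length {P} {m} xs mult≡ m↔P =
      cantor-schröder-bernstein {f = position} {g = element} position-injective element-injective
      where
      open Inverse m↔P
      Σ-≡ : {u v : Σ A (T ∘ P)} → proj₁ u ≡ proj₁ v → u ≡ v
      Σ-≡ {x , p} {.x , q} refl = cong (x ,_) (T-irrelevant p q)
      ∈xs : ∀ i → proj₁ (to i) ∈ xs
      ∈xs i = multiplicity≥1⇒∈ xs (subst (1 ≤_) (sym (mult≡ _)) (T⇒⟦⟧≥1 (proj₂ (to i))))
      position : Fin m → Fin (length xs)
      position i = index (∈xs i)
      position-injective : ∀ {i j} → position i ≡ position j → i ≡ j
      position-injective {i} {j} pᵢ≡pⱼ = begin
        i            ≡⟨ strictlyInverseʳ i ⟨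
        from (to i)  ≡⟨ cong from (Σ-≡ (trans (lookup-index (∈xs i))
                                        (trans (cong (lookup xs) pᵢ≡pⱼ) (sym (lookup-index (∈xs j)))))) ⟩
        from (to j)  ≡⟨ strictlyInverseʳ j ⟩
        j            ∎
      element : Fin (length xs) → Fin m
      element j = from (lookup xs j , ⟦⟧≥1⇒T (subst (1 ≤_) (mult≡ _) (multiplicity-lookup xs j)))
      element-injective : ∀ {i j} → element i ≡ element j → i ≡ j
      element-injective eᵢ≡eⱼ = lookup-injective xs (λ x → subst (_≤ 1) (sym (mult≡ x)) (⟦⟧≤1 (P x))) _ _
        (cong proj₁ (trans (sym (strictlyInverseˡ _)) (trans (cong to eᵢ≡eⱼ) (strictlyInverseˡ _))))

module Labels where
  open import Data.Bool using (_∧_; T)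
  open import Data.Bool.ListAction using (any)
  open import Data.Bool.Properties using (T-∧)
  open import Data.List using (List; []; _∷_; map; length; upTo; applyUpTo; merge)
  open import Data.List.Membership.Propositional using (_∈_)
  open import Data.List.Properties using (map-applyUpTo; ≡-dec)
  open import Data.List.Relation.Binary.Permutation.Propositional using (_↭_; prep; ↭-refl; ↭-sym; ↭-trans)
  open import Data.List.Relation.Binary.Permutation.Propositional.Properties
    using (merge-↭; ++⁺; All-resp-↭; ∈-resp-↭; ↭-length)
  open import Data.List.Relation.Unary.All as All using (All; []; _∷_)
  import Data.List.Relation.Unary.All.Properties as All
  open import Data.List.Relation.Unary.AllPairs using (AllPairs; []; _∷_)
  open import Data.List.Relation.Unary.Any as Any using (here; there)
  open import Data.List.Relation.Unary.Any.Properties using (any⁺; any⁻)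
  open import Data.List.Relation.Unary.Linked.Properties using (AllPairs⇒Linked)
  open import Data.List.Relation.Unary.Sorted.TotalOrder.Properties using (merge⁺; Sorted⇒AllPairs)
  open import Data.Nat using (_≤?_; _≡ᵇ_)
  open import Data.Product using (_×_; _,_)
  open import Data.Sum using (inj₁; inj₂)
  open import Function using (id; _⇔_; mk⇔; Equivalence)
  open import Relation.Binary.Definitions using (DecidableEquality)
  open import Relation.Nullary using (does; yes; no; contradiction)
  open import Relation.Nullary.Decidable using (map′; _×-dec_; T?; does-≡)

  infix 4 _≟ᵗ_ _≟ₗ_

  _≟ᵗ_ : DecidableEquality Tree
  ∅          ≟ᵗ ∅             = yes refl
  ∅          ≟ᵗ node _ _ _    = no λ ()
  node _ _ _ ≟ᵗ ∅             = no λ ()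
  node l x r ≟ᵗ node l′ x′ r′ =
    map′ (λ (l≡ , x≡ , r≡) → cong₂ (λ (l , x) r → node l x r) (cong₂ _,_ l≡ x≡) r≡)
         (λ { refl → refl , refl , refl })
         (l ≟ᵗ l′ ×-dec x ℕ.≟ x′ ×-dec r ≟ᵗ r′)

  _≟ₗ_ : DecidableEquality (List ℕ)
  _≟ₗ_ = ≡-dec ℕ._≟_

  T-∧⁻ : ∀ a {b} → T (a ∧ b) → T a × T b
  T-∧⁻ a = Equivalence.to (T-∧ {a})

  -- Label sets are represented canonically by sorted lists, so that "t is labelled by exactly
  -- the elements of L" becomes the decidable equation sortedLabels t ≡ L.
  sortedLabels : Tree → List ℕ
  sortedLabels ∅            = []
  sortedLabels (node l x r) = x ∷ merge _≤?_ (sortedLabels l) (sortedLabels r)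

  sortedLabels↭labels : ∀ t → sortedLabels t ↭ labels t
  sortedLabels↭labels ∅            = ↭-refl
  sortedLabels↭labels (node l x r) = prep x (↭-trans (merge-↭ _≤?_ (sortedLabels l) (sortedLabels r))
                                                     (++⁺ (sortedLabels↭labels l) (sortedLabels↭labels r)))

  below⇒All≤ : ∀ x t → T (below x t) → AllPairs _≤_ (sortedLabels t) → All (x ≤_) (sortedLabels t)
  below⇒All≤ x ∅            _   _        = []
  below⇒All≤ x (node l y r) x<y (y≤ ∷ _) = x≤y ∷ All.map (ℕ.≤-trans x≤y) y≤
    where x≤y = ℕ.<⇒≤ (ℕ.<ᵇ⇒< x y x<y)

  sortedLabels-sorted : ∀ t → T (increasing t) → AllPairs _≤_ (sortedLabels t)
  sortedLabels-sorted ∅            _   = []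
  sortedLabels-sorted (node l x r) inc =
    let bl , inc′ = T-∧⁻ (below x l) inc
        br , inc″ = T-∧⁻ (below x r) inc′
        il , ir   = T-∧⁻ (increasing l) inc″
        sl = sortedLabels-sorted l il
        sr = sortedLabels-sorted r ir
    in All-resp-↭ (↭-sym (merge-↭ _≤?_ (sortedLabels l) (sortedLabels r)))
                  (All.++⁺ (below⇒All≤ x l bl sl) (below⇒All≤ x r br sr))
       ∷ Sorted⇒AllPairs ℕ.≤-totalOrder (merge⁺ ℕ.≤-decTotalOrder (AllPairs⇒Linked sl) (AllPairs⇒Linked sr))

  upFrom : ℕ → ℕ → List ℕ
  upFrom a zero    = []
  upFrom a (suc n) = a ∷ upFrom (suc a) n

  length-upFrom : ∀ a n → length (upFrom a n) ≡ n
  length-upFrom a zero    = refl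
  length-upFrom a (suc n) = cong suc (length-upFrom (suc a) n)

  upFrom-≥ : ∀ a n → All (a ≤_) (upFrom a n)
  upFrom-≥ a zero    = []
  upFrom-≥ a (suc n) = ℕ.≤-refl ∷ All.map ℕ.<⇒≤ (upFrom-≥ (suc a) n)

  upFrom-strict : ∀ a n → AllPairs _<_ (upFrom a n)
  upFrom-strict a zero    = []
  upFrom-strict a (suc n) = upFrom-≥ (suc a) n ∷ upFrom-strict (suc a) n

  map-suc-upTo : ∀ n → map suc (upTo n) ≡ upFrom 1 n
  map-suc-upTo n = trans (map-applyUpTo id suc n) (applyUpTo≡upFrom suc 1 n (λ _ → refl))
    where
    applyUpTo≡upFrom : ∀ f a n → (∀ i → f i ≡ a ℕ.+ i) → applyUpTo f n ≡ upFrom a n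
    applyUpTo≡upFrom f a zero    f≡ = refl
    applyUpTo≡upFrom f a (suc n) f≡ = cong₂ _∷_ (trans (f≡ 0) (ℕ.+-identityʳ a))
      (applyUpTo≡upFrom (f ∘ suc) (suc a) n (λ i → trans (f≡ (suc i)) (ℕ.+-suc a i)))

  ∈-tail : ∀ {k y ys} → y < k → k ∈ y ∷ ys → k ∈ ys
  ∈-tail y<k (here k≡y)   = contradiction (sym k≡y) (ℕ.<⇒≢ y<k)
  ∈-tail y<k (there k∈ys) = k∈ys

  head-≤ : ∀ {k y ys} → All (y ≤_) ys → k ∈ y ∷ ys → y ≤ k
  head-≤ y≤ys (here refl)  = ℕ.≤-refl
  head-≤ y≤ys (there k∈ys) = All.lookup y≤ys k∈ys

  uncover-head : ∀ {y ys b} m → y < b → All (_∈ y ∷ ys) (upFrom b m) → All (_∈ ys) (upFrom b m)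
  uncover-head {b = b} m y<b cover =
    All.zipWith (λ (b≤k , k∈) → ∈-tail (ℕ.<-≤-trans y<b b≤k) k∈) (upFrom-≥ b m , cover)

  sorted-covering⇒upFrom : ∀ {xs} a n → AllPairs _≤_ xs → length xs ≤ n → All (_∈ xs) (upFrom a n) →
                           xs ≡ upFrom a n
  sorted-covering⇒upFrom {[]}     a zero    _ _ _ = refl
  sorted-covering⇒upFrom {[]}     a (suc n) _ _ (() ∷ _)
  sorted-covering⇒upFrom {y ∷ ys} a (suc n) (y≤ys ∷ sorted) (s≤s |ys|≤n) (a∈ ∷ cover)
    with ℕ.m≤n⇒m<n∨m≡n (head-≤ y≤ys a∈)
  ... | inj₁ y<a  = contradiction (subst (_≤ n) (trans (cong length ys≡) (length-upFrom a (suc n))) |ys|≤n)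
                                  (ℕ.<-irrefl refl)
    where ys≡ = sorted-covering⇒upFrom a (suc n) sorted (ℕ.m≤n⇒m≤1+n |ys|≤n) (uncover-head (suc n) y<a (a∈ ∷ cover))
  ... | inj₂ refl = cong (y ∷_) (sorted-covering⇒upFrom (suc y) n sorted |ys|≤n (uncover-head n ℕ.≤-refl cover))

  T-any≡ᵇ⇔∈ : ∀ {k} xs → T (any (λ y → y ≡ᵇ k) xs) ⇔ k ∈ xs
  T-any≡ᵇ⇔∈ {k} xs = mk⇔
    (Any.map (λ {y} y≡ᵇk → sym (ℕ.≡ᵇ⇒≡ y k y≡ᵇk)) ∘ any⁻ _ xs)
    (any⁺ _ ∘ Any.map (λ {y} k≡y → ℕ.≡⇒≡ᵇ y k (sym k≡y)))

  labelsAre1ton⇔ : ∀ n t → T (increasing t) → T (labelsAre1ton n t) ⇔ sortedLabels t ≡ upFrom 1 n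
  labelsAre1ton⇔ n t inc = mk⇔ to from
    where
    ↭labels = sortedLabels↭labels t
    to : T (labelsAre1ton n t) → sortedLabels t ≡ upFrom 1 n
    to h = let length≡ , covering = T-∧⁻ (length (labels t) ≡ᵇ n) h in
      sorted-covering⇒upFrom 1 n (sortedLabels-sorted t inc)
        (ℕ.≤-reflexive (trans (↭-length ↭labels) (ℕ.≡ᵇ⇒≡ _ n length≡)))
        (subst (All (_∈ sortedLabels t)) (map-suc-upTo n)
          (All.map (∈-resp-↭ (↭-sym ↭labels) ∘ Equivalence.to (T-any≡ᵇ⇔∈ (labels t))) (All.all⁺ _ _ covering)))
    from : sortedLabels t ≡ upFrom 1 n → T (labelsAre1ton n t)
    from sorted≡ = Equivalence.from T-∧
      ( ℕ.≡⇒≡ᵇ (length (labels t)) n (trans (sym (↭-length ↭labels)) (trans (cong length sorted≡) (length-upFrom 1 n)))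
      , All.all⁻ _ (subst (All _) (sym (map-suc-upTo n))
          (All.map (Equivalence.from (T-any≡ᵇ⇔∈ (labels t)) ∘ ∈-resp-↭ ↭labels)
                   (subst (λ xs → All (_∈ xs) (upFrom 1 n)) (sym sorted≡) (All.tabulate id)))))

  labelsAre1ton≡ : ∀ n t → T (increasing t) → labelsAre1ton n t ≡ does (sortedLabels t ≟ₗ upFrom 1 n)
  labelsAre1ton≡ n t inc = does-≡ (map′ to from (T? (labelsAre1ton n t))) (sortedLabels t ≟ₗ upFrom 1 n)
    where open Equivalence (labelsAre1ton⇔ n t inc)

module Shelves where
  open import Algebra.Bundles using (CommutativeMonoid)
  import Algebra.Properties.CommutativeSemigroup as CommutativeSemigroupProperties
  open import Data.Bool using (Bool; true; false; _∧_; T; if_then_else_)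
  open import Data.Bool.Properties using (T-≡; ∧-zeroʳ; ∧-identityʳ; ∧-commutativeMonoid)
  open import Data.Empty using (⊥)
  open import Data.List using (List; []; _∷_; _++_; map; length; null; merge; concatMap; cartesianProductWith)
  open import Data.List.Properties using (length-++; length-map)
  open import Data.List.Relation.Binary.Permutation.Propositional.Properties using (merge-↭; All-resp-↭)
  open import Data.List.Relation.Binary.Sublist.Propositional using (_⊆_; []; _∷_; _∷ʳ_)
  open import Data.List.Relation.Binary.Sublist.Propositional.Properties using (All-resp-⊆; length-mono-≤)
  open import Data.List.Relation.Unary.All as All using (All; []; _∷_)
  import Data.List.Relation.Unary.All.Properties as All
  open import Data.List.Relation.Unary.AllPairs using (AllPairs; []; _∷_)
  open import Data.Nat using (_+_; _*_; _≤?_; _<ᵇ_; _≤ᵇ_; _≡ᵇ_)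
  open import Data.Product using (_×_; _,_; proj₁; proj₂; map₁; map₂)
  open import Function using (Equivalence)
  open import Relation.Binary.Definitions using (DecidableEquality)
  open import Relation.Nullary using (does; yes; no)
  open import Relation.Nullary.Decidable using (map′; _×-dec_; dec-true; dec-false)
  open ≡-Reasoning
  open Leibniz _+_ _*_ using (∂; _⋆_; ⋆-cong-≤)
  open Sums
  open Labels
  module ∧ = CommutativeSemigroupProperties (CommutativeMonoid.commutativeSemigroup ∧-commutativeMonoid)

  AllPairs-resp-⊆ : ∀ {A : Set} {R : A → A → Set} {xs ys} → xs ⊆ ys → AllPairs R ys → AllPairs R xs
  AllPairs-resp-⊆ []           []       = []
  AllPairs-resp-⊆ (y ∷ʳ xs⊆)   (_ ∷ rs) = AllPairs-resp-⊆ xs⊆ rs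
  AllPairs-resp-⊆ (refl ∷ xs⊆) (r ∷ rs) = All-resp-⊆ xs⊆ r ∷ AllPairs-resp-⊆ xs⊆ rs

  merge-[]ʳ : ∀ xs → merge _≤?_ xs [] ≡ xs
  merge-[]ʳ []      = refl
  merge-[]ʳ (_ ∷ _) = refl

  merge-All⁻ : ∀ {P : ℕ → Set} xs ys → All P (merge _≤?_ xs ys) → All P xs × All P ys
  merge-All⁻ xs ys = All.++⁻ xs ∘ All-resp-↭ (merge-↭ _≤?_ xs ys)

  splits : {A : Set} → List A → List (List A × List A)
  splits []       = ([] , []) ∷ []
  splits (y ∷ ys) = map (map₁ (y ∷_)) (splits ys) ++ map (map₂ (y ∷_)) (splits ys)

  splits-⊆ : ∀ {A : Set} (L : List A) → All (λ (xs , ys) → xs ⊆ L × ys ⊆ L) (splits L)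
  splits-⊆ []       = ([] , []) ∷ []
  splits-⊆ (y ∷ ys) = All.++⁺
    (All.map⁺ (All.map (λ (xs⊆ , ys⊆) → refl ∷ xs⊆ , y ∷ʳ ys⊆) (splits-⊆ ys)))
    (All.map⁺ (All.map (λ (xs⊆ , ys⊆) → y ∷ʳ xs⊆ , refl ∷ ys⊆) (splits-⊆ ys)))

  ∑-splits-∷ : ∀ {A : Set} y (ys : List A) f →
               ∑ (splits (y ∷ ys)) f ≡ (∑[ (xs , zs) ∈ splits ys ] f (y ∷ xs , zs))
                                       + (∑[ (xs , zs) ∈ splits ys ] f (xs , y ∷ zs))
  ∑-splits-∷ y ys f = trans (∑-++ (map (map₁ (y ∷_)) (splits ys)) (map (map₂ (y ∷_)) (splits ys)) f)
                            (cong₂ _+_ (∑-map (map₁ (y ∷_)) (splits ys) f) (∑-map (map₂ (y ∷_)) (splits ys) f))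

  ∑-splits-⋆ : ∀ (u v : ℕ → ℕ) {A : Set} (L : List A) →
               ∑[ (xs , ys) ∈ splits L ] u (length xs) * v (length ys) ≡ (u ⋆ v) (length L)
  ∑-splits-⋆ u v []       = ℕ.+-identityʳ (u 0 * v 0)
  ∑-splits-⋆ u v (y ∷ ys) = trans (∑-splits-∷ y ys _) (cong₂ _+_ (∑-splits-⋆ (∂ u) v ys) (∑-splits-⋆ u (∂ v) ys))

  ∑-splits-null : ∀ (h : ℕ → ℕ) {A : Set} (L : List A) →
                  ∑[ (xs , ys) ∈ splits L ] ⟦ null ys ⟧ * h (length xs) ≡ h (length L)
  ∑-splits-null h []       = trans (ℕ.+-identityʳ _) (ℕ.+-identityʳ (h 0))
  ∑-splits-null h (y ∷ ys) = trans (∑-splits-∷ y ys _)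
    (trans (cong₂ _+_ (∑-splits-null (h ∘ suc) ys) (∑-zero (splits ys))) (ℕ.+-identityʳ (h (suc (length ys)))))

  infix 4 _≟ₚ_
  _≟ₚ_ : DecidableEquality (List ℕ × List ℕ)
  (A , B) ≟ₚ (A′ , B′) = map′ (λ (A≡ , B≡) → cong₂ _,_ A≡ B≡) (λ { refl → refl , refl }) (A ≟ₗ A′ ×-dec B ≟ₗ B′)

  open Multiplicity _≟ₚ_ using () renaming (multiplicity to #splits)

  #splits-merge : ∀ {L} → AllPairs _<_ L → ∀ A B → #splits (A , B) (splits L) ≡ ⟦ does (merge _≤?_ A B ≟ₗ L) ⟧
  #splits-merge {[]}     _               []      []      = refl
  #splits-merge {[]}     _               []      (_ ∷ _) = refl
  #splits-merge {[]}     _               (_ ∷ _) []      = refl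
  #splits-merge {[]}     _               (a ∷ _) (b ∷ _) with a ≤ᵇ b
  ... | true  = refl
  ... | false = refl
  #splits-merge {y ∷ ys} (y<ys ∷ strict) A B = trans (∑-splits-∷ y ys _) (cases A B)
    where
    S = splits ys
    left right : List ℕ → List ℕ → ℕ
    left  A B = ∑[ (A′ , B′) ∈ S ] ⟦ does (A ≟ₗ y ∷ A′) ∧ does (B ≟ₗ B′) ⟧
    right A B = ∑[ (A′ , B′) ∈ S ] ⟦ does (A ≟ₗ A′) ∧ does (B ≟ₗ y ∷ B′) ⟧

    left-[] : ∀ B → left [] B ≡ 0
    left-[] B = ∑-zero S
    right-[] : ∀ A → right A [] ≡ 0
    right-[] A = trans (∑-cong S (λ {(A′ , _)} _ → cong ⟦_⟧ (∧-zeroʳ (does (A ≟ₗ A′))))) (∑-zero S)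
    left-∷ : ∀ a A B → left (a ∷ A) B ≡ ⟦ a ≡ᵇ y ⟧ * ⟦ does (merge _≤?_ A B ≟ₗ ys) ⟧
    left-∷ a A B with a ≡ᵇ y
    ... | true  = trans (#splits-merge strict A B) (sym (ℕ.+-identityʳ _))
    ... | false = ∑-zero S
    right-∷ : ∀ A b B → right A (b ∷ B) ≡ ⟦ b ≡ᵇ y ⟧ * ⟦ does (merge _≤?_ A B ≟ₗ ys) ⟧
    right-∷ A b B with b ≡ᵇ y
    ... | true  = trans (#splits-merge strict A B) (sym (ℕ.+-identityʳ _))
    ... | false = right-[] A

    cases : ∀ A B → left A B + right A B ≡ ⟦ does (merge _≤?_ A B ≟ₗ y ∷ ys) ⟧
    cases []      []      = cong₂ _+_ (left-[] []) (right-[] [])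
    cases (a ∷ A) []      = begin
      left (a ∷ A) [] + right (a ∷ A) []
        ≡⟨ cong₂ _+_ (left-∷ a A []) (right-[] (a ∷ A)) ⟩
      ⟦ a ≡ᵇ y ⟧ * ⟦ does (merge _≤?_ A [] ≟ₗ ys) ⟧ + 0
        ≡⟨ ℕ.+-identityʳ _ ⟩
      ⟦ a ≡ᵇ y ⟧ * ⟦ does (merge _≤?_ A [] ≟ₗ ys) ⟧
        ≡⟨ cong (λ A′ → ⟦ a ≡ᵇ y ⟧ * ⟦ does (A′ ≟ₗ ys) ⟧) (merge-[]ʳ A) ⟩
      ⟦ a ≡ᵇ y ⟧ * ⟦ does (A ≟ₗ ys) ⟧
        ≡⟨ ⟦∧⟧ (a ≡ᵇ y) (does (A ≟ₗ ys)) ⟨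
      ⟦ (a ≡ᵇ y) ∧ does (A ≟ₗ ys) ⟧
        ∎
    cases []      (b ∷ B) =
      trans (cong₂ _+_ (left-[] (b ∷ B)) (right-∷ [] b B)) (sym (⟦∧⟧ (b ≡ᵇ y) (does (B ≟ₗ ys))))
    cases (a ∷ A) (b ∷ B) with a ≤ᵇ b in a≤ᵇb
    ... | true  = trans (cong₂ _+_ (left-∷ a A (b ∷ B)) (trans (right-∷ (a ∷ A) b B) (⟦⟧*⟦⟧≡0 b≢y)))
                        (trans (ℕ.+-identityʳ _) (sym (⟦∧⟧ (a ≡ᵇ y) _)))
      where
      b≢y : T (b ≡ᵇ y) → T (does (merge _≤?_ (a ∷ A) B ≟ₗ ys)) → ⊥
      b≢y b≡ᵇy merged
        with ℕ.≡ᵇ⇒≡ b y b≡ᵇy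
           | merge-All⁻ (a ∷ A) B (subst (All (y <_)) (sym (T-does⇒ (merge _≤?_ (a ∷ A) B ≟ₗ ys) merged)) y<ys)
      ... | refl | (y<a ∷ _) , _ = ℕ.<⇒≱ y<a (ℕ.≤ᵇ⇒≤ a b (subst T (sym a≤ᵇb) _))
    ... | false = trans (cong₂ _+_ (trans (left-∷ a A (b ∷ B)) (⟦⟧*⟦⟧≡0 a≢y)) (right-∷ (a ∷ A) b B))
                        (sym (⟦∧⟧ (b ≡ᵇ y) _))
      where
      a≢y : T (a ≡ᵇ y) → T (does (merge _≤?_ A (b ∷ B) ≟ₗ ys)) → ⊥
      a≢y a≡ᵇy merged
        with ℕ.≡ᵇ⇒≡ a y a≡ᵇy
           | merge-All⁻ A (b ∷ B) (subst (All (y <_)) (sym (T-does⇒ (merge _≤?_ A (b ∷ B) ≟ₗ ys) merged)) y<ys)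
      ... | refl | _ , (y<b ∷ _) = subst T a≤ᵇb (ℕ.≤⇒≤ᵇ (ℕ.<⇒≤ y<b))

  headsBad : List ℕ → List ℕ → Bool
  headsBad (a ∷ _) (b ∷ _) = a <ᵇ b
  headsBad _       _       = false

  badPair≡headsBad : ∀ l r → badPair l r ≡ headsBad (sortedLabels l) (sortedLabels r)
  badPair≡headsBad ∅            ∅            = refl
  badPair≡headsBad ∅            (node _ _ _) = refl
  badPair≡headsBad (node _ _ _) ∅            = refl
  badPair≡headsBad (node _ _ _) (node _ _ _) = refl

  admissible : List ℕ × List ℕ → Bool
  admissible (A , B) = not (headsBad A B)

  admissible-left : ∀ {y} A B → All (y <_) B → admissible (y ∷ A , B) ≡ null B
  admissible-left     A []      _         = refl
  admissible-left {y} A (b ∷ B) (y<b ∷ _) = cong not (dec-true (y ℕ.<? b) y<b)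

  admissible-right : ∀ {y} A B → All (y <_) A → admissible (A , y ∷ B) ≡ true
  admissible-right     []      B _         = refl
  admissible-right {y} (a ∷ A) B (y<a ∷ _) = cong not (dec-false (a ℕ.<? y) (ℕ.<⇒≯ y<a))

  nodes : List Tree → ℕ → List Tree → List Tree
  nodes ls x rs = cartesianProductWith (λ l r → node l x r) ls rs

  -- k is fuel: shelves k L is the intended enumeration once length L ≤ k.
  shelves : ℕ → List ℕ → List Tree
  shelves _       []      = ∅ ∷ []
  shelves zero    (_ ∷ _) = []
  shelves (suc k) (x ∷ L) =
    concatMap (λ (A , B) → if admissible (A , B) then nodes (shelves k A) x (shelves k B) else []) (splits L)

  avoiding : Tree → Bool
  avoiding t = increasing t ∧ avoidsP t

  shelfOn : List ℕ → Tree → Bool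
  shelfOn L t = does (sortedLabels t ≟ₗ L) ∧ avoiding t

  open Multiplicity _≟ᵗ_ using (enumeration⇒≡length) renaming (multiplicity to #)

  #-if : ∀ t c xs → # t (if c then xs else []) ≡ ⟦ c ⟧ * # t xs
  #-if t true  xs = sym (ℕ.+-identityʳ (# t xs))
  #-if t false xs = refl

  #-nodes : ∀ l y r ls x rs → # (node l y r) (nodes ls x rs) ≡ # l ls * (⟦ y ≡ᵇ x ⟧ * # r rs)
  #-nodes l y r []        x rs = refl
  #-nodes l y r (l′ ∷ ls) x rs = begin
    ∑ (map (node l′ x) rs ++ nodes ls x rs) _
      ≡⟨ ∑-++ (map (node l′ x) rs) (nodes ls x rs) _ ⟩
    ∑ (map (node l′ x) rs) _ + # (node l y r) (nodes ls x rs)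
      ≡⟨ cong₂ _+_ (trans (∑-map (node l′ x) rs _) first-row) (#-nodes l y r ls x rs) ⟩
    ⟦ does (l ≟ᵗ l′) ⟧ * c + # l ls * c
      ≡⟨ ℕ.*-distribʳ-+ c ⟦ does (l ≟ᵗ l′) ⟧ (# l ls) ⟨
    # l (l′ ∷ ls) * c
      ∎
    where
    c = ⟦ y ≡ᵇ x ⟧ * # r rs
    first-row : ∑[ r′ ∈ rs ] ⟦ does (l ≟ᵗ l′) ∧ ((y ≡ᵇ x) ∧ does (r ≟ᵗ r′)) ⟧ ≡ ⟦ does (l ≟ᵗ l′) ⟧ * c
    first-row = begin
      ∑[ r′ ∈ rs ] ⟦ does (l ≟ᵗ l′) ∧ ((y ≡ᵇ x) ∧ does (r ≟ᵗ r′)) ⟧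
        ≡⟨ ∑-cong rs (λ {r′} _ → trans (⟦∧⟧ (does (l ≟ᵗ l′)) _)
                                       (cong (⟦ does (l ≟ᵗ l′) ⟧ *_) (⟦∧⟧ (y ≡ᵇ x) (does (r ≟ᵗ r′))))) ⟩
      ∑[ r′ ∈ rs ] ⟦ does (l ≟ᵗ l′) ⟧ * (⟦ y ≡ᵇ x ⟧ * ⟦ does (r ≟ᵗ r′) ⟧)
        ≡⟨ ∑-*ˡ ⟦ does (l ≟ᵗ l′) ⟧ _ rs ⟩
      ⟦ does (l ≟ᵗ l′) ⟧ * (∑[ r′ ∈ rs ] ⟦ y ≡ᵇ x ⟧ * ⟦ does (r ≟ᵗ r′) ⟧)
        ≡⟨ cong (⟦ does (l ≟ᵗ l′) ⟧ *_) (∑-*ˡ ⟦ y ≡ᵇ x ⟧ _ rs) ⟩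
      ⟦ does (l ≟ᵗ l′) ⟧ * c
        ∎

  #∅-nodes : ∀ ls x rs → # ∅ (nodes ls x rs) ≡ 0
  #∅-nodes []        x rs = refl
  #∅-nodes (l′ ∷ ls) x rs = begin
    ∑ (map (node l′ x) rs ++ nodes ls x rs) _
      ≡⟨ ∑-++ (map (node l′ x) rs) (nodes ls x rs) _ ⟩
    ∑ (map (node l′ x) rs) _ + # ∅ (nodes ls x rs)
      ≡⟨ cong₂ _+_ (trans (∑-map (node l′ x) rs _) (∑-zero rs)) (#∅-nodes ls x rs) ⟩
    0
      ∎

  nodeConditions : Tree → ℕ → ℕ → Tree → Bool
  nodeConditions l y x r = admissible (sortedLabels l , sortedLabels r) ∧ (avoiding l ∧ ((y ≡ᵇ x) ∧ avoiding r))

  split-conditions : ∀ l y x r A B →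
    ⟦ admissible (A , B) ⟧ * (⟦ shelfOn A l ⟧ * (⟦ y ≡ᵇ x ⟧ * ⟦ shelfOn B r ⟧))
    ≡ ⟦ does ((sortedLabels l , sortedLabels r) ≟ₚ (A , B)) ⟧ * ⟦ nodeConditions l y x r ⟧
  split-conditions l y x r A B = begin
    ⟦ admissible (A , B) ⟧ * (⟦ shelfOn A l ⟧ * (⟦ y ≡ᵇ x ⟧ * ⟦ shelfOn B r ⟧))
      ≡⟨ ⟦∧⟧³ (admissible (A , B)) (shelfOn A l) (y ≡ᵇ x) (shelfOn B r) ⟨
    ⟦ admissible (A , B) ∧ (shelfOn A l ∧ ((y ≡ᵇ x) ∧ shelfOn B r)) ⟧
      ≡⟨ cong ⟦_⟧ conditions ⟩
    ⟦ (does (sortedLabels l ≟ₗ A) ∧ does (sortedLabels r ≟ₗ B)) ∧ nodeConditions l y x r ⟧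
      ≡⟨ ⟦∧⟧ (does (sortedLabels l ≟ₗ A) ∧ does (sortedLabels r ≟ₗ B)) _ ⟩
    ⟦ does ((sortedLabels l , sortedLabels r) ≟ₚ (A , B)) ⟧ * ⟦ nodeConditions l y x r ⟧
      ∎
    where
    conditions : admissible (A , B) ∧ ((does (sortedLabels l ≟ₗ A) ∧ avoiding l)
                                       ∧ ((y ≡ᵇ x) ∧ (does (sortedLabels r ≟ₗ B) ∧ avoiding r)))
                 ≡ (does (sortedLabels l ≟ₗ A) ∧ does (sortedLabels r ≟ₗ B)) ∧ nodeConditions l y x r
    conditions with sortedLabels l ≟ₗ A | sortedLabels r ≟ₗ B
    ... | yes refl | yes refl = refl
    ... | no _     | _        = ∧-zeroʳ (admissible (A , B))
    ... | yes refl | no _     = begin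
      admissible (A , B) ∧ (avoiding l ∧ ((y ≡ᵇ x) ∧ false))
        ≡⟨ cong (λ b → admissible (A , B) ∧ (avoiding l ∧ b)) (∧-zeroʳ (y ≡ᵇ x)) ⟩
      admissible (A , B) ∧ (avoiding l ∧ false)
        ≡⟨ cong (admissible (A , B) ∧_) (∧-zeroʳ (avoiding l)) ⟩
      admissible (A , B) ∧ false
        ≡⟨ ∧-zeroʳ (admissible (A , B)) ⟩
      false
        ∎

  below-true : ∀ {y} t → All (y <_) (sortedLabels t) → below y t ≡ true
  below-true ∅            _         = refl
  below-true (node _ z _) (y<z ∷ _) = Equivalence.to T-≡ (ℕ.<⇒<ᵇ y<z)

  root-conditions : ∀ x L l y r → All (x <_) L →
    ⟦ does (merge _≤?_ (sortedLabels l) (sortedLabels r) ≟ₗ L) ⟧ * ⟦ nodeConditions l y x r ⟧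
    ≡ ⟦ shelfOn (x ∷ L) (node l y r) ⟧
  root-conditions x L l y r x<L = trans (sym (⟦∧⟧ (does (merged ≟ₗ L)) _)) (cong ⟦_⟧ conditions)
    where
    merged = merge _≤?_ (sortedLabels l) (sortedLabels r)
    adm = admissible (sortedLabels l , sortedLabels r)
    conditions : does (merged ≟ₗ L) ∧ nodeConditions l y x r
                 ≡ ((y ≡ᵇ x) ∧ does (merged ≟ₗ L))
                   ∧ ((below y l ∧ below y r ∧ increasing l ∧ increasing r)
                      ∧ (not (badPair l r) ∧ avoidsP l ∧ avoidsP r))
    conditions with merged ≟ₗ L | y ≡ᵇ x in y≡ᵇx
    ... | no _          | e     = sym (cong (_∧ _) (∧-zeroʳ e))
    ... | yes _         | false = trans (cong (adm ∧_) (∧-zeroʳ (avoiding l))) (∧-zeroʳ adm)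
    ... | yes merged≡L  | true  = begin
      adm ∧ ((increasing l ∧ avoidsP l) ∧ (increasing r ∧ avoidsP r))
        ≡⟨ cong (adm ∧_) (∧.interchange (increasing l) (avoidsP l) (increasing r) (avoidsP r)) ⟩
      adm ∧ ((increasing l ∧ increasing r) ∧ (avoidsP l ∧ avoidsP r))
        ≡⟨ ∧.x∙yz≈y∙xz adm (increasing l ∧ increasing r) (avoidsP l ∧ avoidsP r) ⟩
      (increasing l ∧ increasing r) ∧ (adm ∧ avoidsP l ∧ avoidsP r)
        ≡⟨ cong (λ bad → (increasing l ∧ increasing r) ∧ (not bad ∧ avoidsP l ∧ avoidsP r)) (badPair≡headsBad l r) ⟨
      (increasing l ∧ increasing r) ∧ (not (badPair l r) ∧ avoidsP l ∧ avoidsP r)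
        ≡⟨ cong₂ (λ bl br → (bl ∧ br ∧ increasing l ∧ increasing r) ∧ (not (badPair l r) ∧ avoidsP l ∧ avoidsP r))
                 (below-true l (proj₁ y<children)) (below-true r (proj₂ y<children)) ⟨
      (below y l ∧ below y r ∧ increasing l ∧ increasing r) ∧ (not (badPair l r) ∧ avoidsP l ∧ avoidsP r)
        ∎
      where
      y≡x = ℕ.≡ᵇ⇒≡ y x (subst T (sym y≡ᵇx) _)
      y<children = merge-All⁻ (sortedLabels l) (sortedLabels r)
        (subst (λ z → All (z <_) merged) (sym y≡x) (subst (All (x <_)) (sym merged≡L) x<L))

  #shelves : ∀ k L → AllPairs _<_ L → length L ≤ k → ∀ t → # t (shelves k L) ≡ ⟦ shelfOn L t ⟧
  #shelves k       []      _              _           ∅            = refl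
  #shelves k       []      _              _           (node _ _ _) = refl
  #shelves (suc k) (x ∷ L) _              _           ∅            = begin
    # ∅ (concatMap _ (splits L))
      ≡⟨ ∑-concatMap _ (splits L) _ ⟩
    ∑[ p ∈ splits L ] # ∅ (if admissible p then _ else [])
      ≡⟨ ∑-cong (splits L) (λ {(A , B)} _ →
           trans (#-if ∅ (admissible (A , B)) _)
                 (cong (⟦ admissible (A , B) ⟧ *_) (#∅-nodes (shelves k A) x (shelves k B)))) ⟩
    ∑[ p ∈ splits L ] ⟦ admissible p ⟧ * 0
      ≡⟨ ∑-*ʳ 0 (⟦_⟧ ∘ admissible) (splits L) ⟩
    ∑ (splits L) (⟦_⟧ ∘ admissible) * 0
      ≡⟨ ℕ.*-zeroʳ (∑ (splits L) (⟦_⟧ ∘ admissible)) ⟩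
    0
      ∎
  #shelves (suc k) (x ∷ L) (x<L ∷ strict) (s≤s |L|≤k) (node l y r) = begin
    # (node l y r) (concatMap _ (splits L))
      ≡⟨ ∑-concatMap _ (splits L) _ ⟩
    ∑[ p ∈ splits L ] # (node l y r) (if admissible p then _ else [])
      ≡⟨ ∑-cong (splits L) (λ {(A , B)} _ →
           trans (#-if (node l y r) (admissible (A , B)) _)
                 (cong (⟦ admissible (A , B) ⟧ *_) (#-nodes l y r (shelves k A) x (shelves k B)))) ⟩
    ∑[ (A , B) ∈ splits L ] ⟦ admissible (A , B) ⟧ * (# l (shelves k A) * (⟦ y ≡ᵇ x ⟧ * # r (shelves k B)))
      ≡⟨ ∑-cong (splits L) (λ {(A , B)} AB∈ → induction A B (All.lookup (splits-⊆ L) AB∈)) ⟩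
    ∑[ (A , B) ∈ splits L ] ⟦ admissible (A , B) ⟧ * (⟦ shelfOn A l ⟧ * (⟦ y ≡ᵇ x ⟧ * ⟦ shelfOn B r ⟧))
      ≡⟨ ∑-cong (splits L) (λ {(A , B)} _ → split-conditions l y x r A B) ⟩
    ∑[ p ∈ splits L ] ⟦ does ((sortedLabels l , sortedLabels r) ≟ₚ p) ⟧ * ⟦ nodeConditions l y x r ⟧
      ≡⟨ ∑-*ʳ ⟦ nodeConditions l y x r ⟧ _ (splits L) ⟩
    #splits (sortedLabels l , sortedLabels r) (splits L) * ⟦ nodeConditions l y x r ⟧
      ≡⟨ cong (_* ⟦ nodeConditions l y x r ⟧) (#splits-merge strict (sortedLabels l) (sortedLabels r)) ⟩
    ⟦ does (merge _≤?_ (sortedLabels l) (sortedLabels r) ≟ₗ L) ⟧ * ⟦ nodeConditions l y x r ⟧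
      ≡⟨ root-conditions x L l y r x<L ⟩
    ⟦ shelfOn (x ∷ L) (node l y r) ⟧
      ∎
    where
    induction : ∀ A B → A ⊆ L × B ⊆ L →
                ⟦ admissible (A , B) ⟧ * (# l (shelves k A) * (⟦ y ≡ᵇ x ⟧ * # r (shelves k B)))
                ≡ ⟦ admissible (A , B) ⟧ * (⟦ shelfOn A l ⟧ * (⟦ y ≡ᵇ x ⟧ * ⟦ shelfOn B r ⟧))
    induction A B (A⊆L , B⊆L) = cong₂ (λ m n → ⟦ admissible (A , B) ⟧ * (m * (⟦ y ≡ᵇ x ⟧ * n)))
      (#shelves k A (AllPairs-resp-⊆ A⊆L strict) (ℕ.≤-trans (length-mono-≤ A⊆L) |L|≤k) l)
      (#shelves k B (AllPairs-resp-⊆ B⊆L strict) (ℕ.≤-trans (length-mono-≤ B⊆L) |L|≤k) r)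

  -- graft F m counts the P-avoiding shelves on m + 1 labels from the counts F on fewer labels:
  -- the second least label lies either in the left subtree, which is then the only one, or at
  -- the root of the right subtree.
  graft : (ℕ → ℕ) → ℕ → ℕ
  graft F zero    = F 0 * F 0
  graft F (suc m) = F (suc m) + (F ⋆ ∂ F) m

  graft-cong : ∀ {F G} m → (∀ {j} → j ≤ m → F j ≡ G j) → graft F m ≡ graft G m
  graft-cong zero    F≡G = cong₂ _*_ (F≡G z≤n) (F≡G z≤n)
  graft-cong (suc m) F≡G = cong₂ _+_ (F≡G ℕ.≤-refl) (⋆-cong-≤ m (F≡G ∘ ℕ.m≤n⇒m≤1+n) (F≡G ∘ s≤s))

  ∑-admissible-splits : ∀ (F : ℕ → ℕ) → F 0 ≡ 1 → ∀ L → AllPairs _<_ L →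
    ∑[ (A , B) ∈ splits L ] ⟦ admissible (A , B) ⟧ * (F (length A) * F (length B)) ≡ graft F (length L)
  ∑-admissible-splits F F₀ []       _               = trans (ℕ.+-identityʳ _) (ℕ.+-identityʳ (F 0 * F 0))
  ∑-admissible-splits F F₀ (y ∷ ys) (y<ys ∷ strict) = begin
    ∑ (splits (y ∷ ys)) _
      ≡⟨ ∑-splits-∷ y ys _ ⟩
    (∑[ (A , B) ∈ S ] ⟦ admissible (y ∷ A , B) ⟧ * (F (suc (length A)) * F (length B)))
    + (∑[ (A , B) ∈ S ] ⟦ admissible (A , y ∷ B) ⟧ * (F (length A) * F (suc (length B))))
      ≡⟨ cong₂ _+_ (∑-cong S (left ∘ All.lookup (splits-⊆ ys))) (∑-cong S (right ∘ All.lookup (splits-⊆ ys))) ⟩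
    (∑[ (A , B) ∈ S ] ⟦ null B ⟧ * F (suc (length A))) + (∑[ (A , B) ∈ S ] F (length A) * F (suc (length B)))
      ≡⟨ cong₂ _+_ (∑-splits-null (F ∘ suc) ys) (∑-splits-⋆ F (∂ F) ys) ⟩
    graft F (length (y ∷ ys))
      ∎
    where
    S = splits ys
    left : ∀ {A B} → A ⊆ ys × B ⊆ ys →
           ⟦ admissible (y ∷ A , B) ⟧ * (F (suc (length A)) * F (length B)) ≡ ⟦ null B ⟧ * F (suc (length A))
    left {A} {[]}    _        = cong (_+ 0) (trans (cong (F (suc (length A)) *_) F₀) (ℕ.*-identityʳ _))
    left {A} {b ∷ B} (_ , B⊆) = cong (λ c → ⟦ c ⟧ * _) (admissible-left A (b ∷ B) (All-resp-⊆ B⊆ y<ys))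
    right : ∀ {A B} → A ⊆ ys × B ⊆ ys →
            ⟦ admissible (A , y ∷ B) ⟧ * (F (length A) * F (suc (length B))) ≡ F (length A) * F (suc (length B))
    right {A} {B} (A⊆ , _) =
      trans (cong (λ c → ⟦ c ⟧ * _) (admissible-right A B (All-resp-⊆ A⊆ y<ys))) (ℕ.+-identityʳ _)

  shelfCount : ℕ → ℕ → ℕ
  shelfCount _       zero    = 1
  shelfCount zero    (suc _) = 0
  shelfCount (suc k) (suc m) = graft (shelfCount k) m

  shelfCount-stable : ∀ {k k′} n → n ≤ k → n ≤ k′ → shelfCount k n ≡ shelfCount k′ n
  shelfCount-stable                  zero    _         _          = refl
  shelfCount-stable {suc k} {suc k′} (suc m) (s≤s m≤k) (s≤s m≤k′) =
    graft-cong m (λ {j} j≤m → shelfCount-stable j (ℕ.≤-trans j≤m m≤k) (ℕ.≤-trans j≤m m≤k′))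

  length-if : ∀ {A : Set} c (xs : List A) → length (if c then xs else []) ≡ ⟦ c ⟧ * length xs
  length-if true  xs = sym (ℕ.+-identityʳ (length xs))
  length-if false xs = refl

  length-nodes : ∀ ls x rs → length (nodes ls x rs) ≡ length ls * length rs
  length-nodes []       x rs = refl
  length-nodes (l ∷ ls) x rs =
    trans (length-++ (map (node l x) rs)) (cong₂ _+_ (length-map (node l x) rs) (length-nodes ls x rs))

  length-shelves : ∀ k L → AllPairs _<_ L → length L ≤ k → length (shelves k L) ≡ shelfCount k (length L)
  length-shelves k       []      _            _           = refl
  length-shelves (suc k) (x ∷ L) (_ ∷ strict) (s≤s |L|≤k) = begin
    length (concatMap _ (splits L))
      ≡⟨ length-concatMap _ (splits L) ⟩
    ∑[ p ∈ splits L ] length (if admissible p then _ else [])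
      ≡⟨ ∑-cong (splits L) (λ {(A , B)} _ →
           trans (length-if (admissible (A , B)) _)
                 (cong (⟦ admissible (A , B) ⟧ *_) (length-nodes (shelves k A) x (shelves k B)))) ⟩
    ∑[ (A , B) ∈ splits L ] ⟦ admissible (A , B) ⟧ * (length (shelves k A) * length (shelves k B))
      ≡⟨ ∑-cong (splits L) (λ {(A , B)} AB∈ → induction A B (All.lookup (splits-⊆ L) AB∈)) ⟩
    ∑[ (A , B) ∈ splits L ] ⟦ admissible (A , B) ⟧ * (shelfCount k (length A) * shelfCount k (length B))
      ≡⟨ ∑-admissible-splits (shelfCount k) refl L strict ⟩
    graft (shelfCount k) (length L)
      ∎
    where
    induction : ∀ A B → A ⊆ L × B ⊆ L →
                ⟦ admissible (A , B) ⟧ * (length (shelves k A) * length (shelves k B))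
                ≡ ⟦ admissible (A , B) ⟧ * (shelfCount k (length A) * shelfCount k (length B))
    induction A B (A⊆L , B⊆L) = cong₂ (λ m n → ⟦ admissible (A , B) ⟧ * (m * n))
      (length-shelves k A (AllPairs-resp-⊆ A⊆L strict) (ℕ.≤-trans (length-mono-≤ A⊆L) |L|≤k))
      (length-shelves k B (AllPairs-resp-⊆ B⊆L strict) (ℕ.≤-trans (length-mono-≤ B⊆L) |L|≤k))

  𝓑≡shelfOn : ∀ n t → (isTShelf n t ∧ avoidsP t) ≡ shelfOn (upFrom 1 n) t
  𝓑≡shelfOn n t with increasing t in inc
  ... | true  = cong (_∧ avoidsP t)
                     (trans (∧-identityʳ (labelsAre1ton n t)) (labelsAre1ton≡ n t (subst T (sym inc) _)))
  ... | false = trans (cong (_∧ avoidsP t) (∧-zeroʳ (labelsAre1ton n t)))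
                      (sym (∧-zeroʳ (does (sortedLabels t ≟ₗ upFrom 1 n))))

  card-𝓑 : ∀ {m} n → Fin m ↔ 𝓑 n → m ≡ shelfCount n n
  card-𝓑 {m} n m↔𝓑 = begin
    m                        ≡⟨ enumeration⇒≡length (shelves n L) #≡ m↔𝓑 ⟩
    length (shelves n L)     ≡⟨ length-shelves n L (upFrom-strict 1 n) |L|≤n ⟩
    shelfCount n (length L)  ≡⟨ cong (shelfCount n) (length-upFrom 1 n) ⟩
    shelfCount n n           ∎
    where
    L = upFrom 1 n
    |L|≤n = ℕ.≤-reflexive (length-upFrom 1 n)
    #≡ : ∀ t → # t (shelves n L) ≡ ⟦ isTShelf n t ∧ avoidsP t ⟧
    #≡ t = trans (#shelves n L (upFrom-strict 1 n) |L|≤n t) (cong ⟦_⟧ (sym (𝓑≡shelfOn n t)))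

  card-𝓑-graft : ∀ (b : ℕ → ℕ) → (∀ n → Fin (b n) ↔ 𝓑 n) → ∀ m → b (suc m) ≡ graft b m
  card-𝓑-graft b b↔𝓑 m = begin
    b (suc m)               ≡⟨ card-𝓑 (suc m) (b↔𝓑 (suc m)) ⟩
    graft (shelfCount m) m  ≡⟨ graft-cong m (λ {j} j≤m → trans (shelfCount-stable j j≤m ℕ.≤-refl)
                                                                (sym (card-𝓑 j (b↔𝓑 j)))) ⟩
    graft b m               ∎

open PowerSeries using (fromℕ-homo-+; fromℕ-homo-*; recurrence⇒egf-identity; _⋆_; ∂)
open Shelves using (card-𝓑; card-𝓑-graft)
open Leibniz ℕ._+_ ℕ._*_ using () renaming (_⋆_ to _⋆ℕ_)
open ≡-Reasoning

corollary8 : (b : ℕ → ℕ) → (∀ n → Fin (b n) ↔ 𝓑 n) →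
    ∀ n → ((((λ k → fromℕ (b k)) ⊝ oneE) ⊛ (coshE ⊝ sinhE)) n) ≡ sinhE n
corollary8 b b↔𝓑 =
  recurrence⇒egf-identity (fromℕ ∘ b) (cong fromℕ (card-𝓑 0 (b↔𝓑 0))) (cong fromℕ (card-𝓑 1 (b↔𝓑 1))) recurrence
  where
  recurrence : ∀ n → fromℕ (b (suc (suc n))) ≡ fromℕ (b (suc n)) ℚ.+ ((fromℕ ∘ b) ⋆ ∂ (fromℕ ∘ b)) n
  recurrence n = begin
    fromℕ (b (suc (suc n)))
      ≡⟨ cong fromℕ (card-𝓑-graft b b↔𝓑 (suc n)) ⟩
    fromℕ (b (suc n) ℕ.+ (b ⋆ℕ (b ∘ suc)) n)
      ≡⟨ fromℕ-homo-+ (b (suc n)) _ ⟩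
    fromℕ (b (suc n)) ℚ.+ fromℕ ((b ⋆ℕ (b ∘ suc)) n)
      ≡⟨ cong (fromℕ (b (suc n)) ℚ.+_) (⋆-homo fromℕ fromℕ-homo-+ fromℕ-homo-* b (b ∘ suc) n) ⟩
    fromℕ (b (suc n)) ℚ.+ ((fromℕ ∘ b) ⋆ ∂ (fromℕ ∘ b)) n
      ∎
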